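{- The abstraction functor $[\mathbb{A}](-)\colon\mathsf{Nom}\to\mathsf{Nom}$ has a locally monotone extension to the Kleisli category $\mathsf{Kl}(\mathcal{P}_{\mathsf{ufs}})$ (hom-sets ordered pointwise by inclusion).
   Context: Fix a countably infinite set $\mathbb{A}$ of names; a nominal set is a set with an action of the group $\mathrm{Perm}(\mathbb{A})$ of finite permutations in which every element $x$ has a finite support, with least support $\mathrm{supp}(x)$; $a\#x$ means $a\notin\mathrm{supp}(x)$. $\mathsf{Nom}$ is the category of nominal sets and equivariant maps. $\mathcal{P}_{\mathsf{ufs}}X$ is the nominal set of uniformly finitely supported subsets of $X$ ($S$ with $\bigcup_{x\in S}\mathrm{supp}(x)$ finite), a monad with unit $x\mapsto\{x\}$ and multiplication union. The abstraction set $[\mathbb{A}]X$ is the quotient of $\mathbb{A}\times X$ by the relation $(a,x)\sim(b,y)$ iff $(a\,c)\cdot x=(b\,c)\cdot y$ for some (equivalently all) $c$ fresh for $a,b,x,y$; the class of $(a,x)$ is written $\langle a\rangle x$, and $[\mathbb{A}]f(\langle a\rangle x)=\langle a\rangle f(x)$. $\mathsf{Kl}(\mathcal{P}_{\mathsf{ufs}})$ has nominal sets as objects and equivariant maps $X\to\mathcal{P}_{\mathsf{ufs}}Y$ as morphisms, composed by $(g\bullet f)(x)=\bigcup_{y\in f(x)}g(y)$; $J\colon\mathsf{Nom}\to\mathsf{Kl}(\mathcal{P}_{\mathsf{ufs}})$ sends $f$ to $x\mapsto\{f(x)\}$. An extension of a functor $F$ is an endofunctor $\bar F$ on $\mathsf{Kl}(\mathcal{P}_{\mathsf{ufs}})$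 with $\bar FJ=JF$; it is locally monotone if $f\le g$ (pointwise inclusion) implies $\bar Ff\le\bar Fg$. -}

module Defs where

open import Data.Nat using (ℕ; _≟_)
open import Data.List using (List; []; _∷_; _++_)
open import Data.List.Membership.Propositional using (_∈_; _∉_)
open import Data.Product using (Σ; ∃; _×_; _,_; proj₁; proj₂)
open import Relation.Binary using (IsEquivalence)
open import Relation.Nullary using (yes; no)
open import Relation.Binary.PropositionalEquality using (_≡_; _≢_)

Name : Set
Name = ℕ

swapName : Name → Name → Name → Name
swapName a b c with c ≟ a | c ≟ b
... | yes _ | _     = b
... | no  _ | yes _ = a
... | no  _ | no  _ = c

-- A finite permutation, presented as a composite of transpositions:
-- (a₁ , b₁) ∷ (a₂ , b₂) ∷ … denotes (a₁ b₁) ∘ (a₂ b₂) ∘ …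
-- Every finite permutation of 𝔸 arises this way; two presentations
-- denote the same permutation iff ⟦_⟧ agrees pointwise.
Perm : Set
Perm = List (Name × Name)

⟦_⟧ : Perm → Name → Name
⟦ [] ⟧          c = c
⟦ (a , b) ∷ p ⟧ c = swapName a b (⟦ p ⟧ c)

-- Nominal sets (setoid presentation, since Agda has no quotients)

record NomStr : Set₁ where
  field
    Carrier : Set
    _≈_     : Carrier → Carrier → Set
    act     : Perm → Carrier → Carrier

open NomStr public

Supports : (X : NomStr) → List Name → Carrier X → Set
Supports X A x =
  ∀ (p : Perm) → (∀ a → a ∈ A → ⟦ p ⟧ a ≡ a) → _≈_ X (act X p x) x

record IsNominal (X : NomStr) : Set where
  field
    isEquivalence : IsEquivalence (_≈_ X)
    act-cong : ∀ p x y → _≈_ X x y → _≈_ X (act X p x) (act X p y)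
    act-ext  : ∀ p q → (∀ a → ⟦ p ⟧ a ≡ ⟦ q ⟧ a) → ∀ x → _≈_ X (act X p x) (act X q x)
    act-id   : ∀ x → _≈_ X (act X [] x) x
    act-comp : ∀ p q x → _≈_ X (act X (p ++ q) x) (act X p (act X q x))
    finSupp  : ∀ x → ∃ λ (A : List Name) → Supports X A x

record NomSet : Set₁ where
  field
    str       : NomStr
    isNominal : IsNominal str

open NomSet public

-- a # x : a is outside the (least) support of x, i.e. some finite
-- support of x omits a.
Fresh : (X : NomStr) → Name → Carrier X → Set
Fresh X c x = ∃ λ (A : List Name) → Supports X A x × c ∉ A

record EqMap (X Y : NomSet) : Set where
  field
    fun      : Carrier (str X) → Carrier (str Y)
    fun-cong : ∀ x x' → _≈_ (str X) x x' → _≈_ (str Y) (fun x) (fun x')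
    equivariant : ∀ p x → _≈_ (str Y) (fun (act (str X) p x)) (act (str Y) p (fun x))

open EqMap public

Abs : NomSet → NomStr
Abs X = record
  { Carrier = Name × Carrier (str X)
  ; _≈_ = λ { (a , x) (b , y) →
        ∃ λ (c : Name) → c ≢ a × c ≢ b × Fresh (str X) c x × Fresh (str X) c y
          × _≈_ (str X) (act (str X) ((a , c) ∷ []) x) (act (str X) ((b , c) ∷ []) y) }
  ; act = λ p → λ { (a , x) → (⟦ p ⟧ a , act (str X) p x) }
  }

Absmap : ∀ (X Y : NomSet) → EqMap X Y → Carrier (Abs X) → Carrier (Abs Y)
Absmap X Y f (a , x) = (a , fun f x)

-- A morphism X → P_ufs Y in Kl(P_ufs): x ↦ {y | rel x y}, where each
-- f(x) is a (≈-closed) subset, the assignment is equivariant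
-- (f(π·x) = π·f(x)) and f(x) is uniformly finitely supported.
record KlHom (X Y : NomStr) : Set₁ where
  field
    rel : Carrier X → Carrier Y → Set
    rel-cong : ∀ x x' y y' → _≈_ X x x' → _≈_ Y y y' → rel x y → rel x' y'
    equivariant  : ∀ p x y → rel x y → rel (act X p x) (act Y p y)
    equivariant⁻ : ∀ p x y → rel (act X p x) (act Y p y) → rel x y
    ufs : ∀ x → ∃ λ (A : List Name) → ∀ y → rel x y → Supports Y A y

open KlHom public

RelK : NomStr → NomStr → Set₁
RelK X Y = Carrier X → Carrier Y → Set

_⊆ʳ_ : ∀ {X Y : NomStr} → RelK X Y → RelK X Y → Set
f ⊆ʳ g = ∀ x y → f x y → g x y

_≐ʳ_ : ∀ {X Y : NomStr} → RelK X Y → RelK X Y → Set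
_≐ʳ_ {X} {Y} f g = (_⊆ʳ_ {X} {Y} f g) × (_⊆ʳ_ {X} {Y} g f)

_•ʳ_ : ∀ {X Y Z : NomStr} → RelK Y Z → RelK X Y → RelK X Z
(g •ʳ f) x z = ∃ λ y → f x y × g y z

-- J h : x ↦ {h x}  (identity = J id : x ↦ {x})
graphʳ : ∀ {X : NomStr} (Y : NomStr) → (Carrier X → Carrier Y) → RelK X Y
graphʳ Y h x y = _≈_ Y (h x) y

idʳ : ∀ (X : NomStr) → RelK X X
idʳ X x y = _≈_ X x y

-- On objects it is forced (by F̄J = JF) to be X ↦ [𝔸]X.
-- Functor laws are stated up to equality of Kleisli morphisms, quantifying
-- over any Kleisli morphism h equal to the relevant composite/identity/J f.
record LocallyMonotoneExtension : Set₂ where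
  field
    ext : ∀ (X Y : NomSet) → KlHom (str X) (str Y) → KlHom (Abs X) (Abs Y)
    ext-id : ∀ {X : NomSet} (h : KlHom (str X) (str X)) →
      _≐ʳ_ {str X} {str X} (rel h) (idʳ (str X)) →
      _≐ʳ_ {Abs X} {Abs X} (rel (ext X X h)) (idʳ (Abs X))
    ext-comp : ∀ {X Y Z : NomSet} (f : KlHom (str X) (str Y)) (g : KlHom (str Y) (str Z))
      (h : KlHom (str X) (str Z)) →
      _≐ʳ_ {str X} {str Z} (rel h) (_•ʳ_ {str X} {str Y} {str Z} (rel g) (rel f)) → _≐ʳ_ {Abs X} {Abs Z} (rel (ext X Z h)) (_•ʳ_ {Abs X} {Abs Y} {Abs Z} (rel (ext Y Z g)) (rel (ext X Y f)))
    ext-J : ∀ {X Y : NomSet} (f : EqMap X Y) (h : KlHom (str X) (str Y)) →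
      _≐ʳ_ {str X} {str Y} (rel h) (graphʳ {str X} (str Y) (fun f)) →
      _≐ʳ_ {Abs X} {Abs Y} (rel (ext X Y h)) (graphʳ {Abs X} (Abs Y) (Absmap X Y f))
    mono : ∀ {X Y : NomSet} (f g : KlHom (str X) (str Y)) →
      _⊆ʳ_ {str X} {str Y} (rel f) (rel g) →
      _⊆ʳ_ {Abs X} {Abs Y} (rel (ext X Y f)) (rel (ext X Y g))

module Submission where

-- [𝔸]h sends ⟨a⟩x to the set of all ⟨a⟩z with z ∈ h(x). The real work is to see
-- that this does not depend on the representative: if ⟨a⟩y = ⟨b⟩y′, a ≠ b, and
-- z ∈ h(y′), take c fresh for everything and z′ = (a c)(b c)·z. Equivariance of h
-- gives z′ ∈ h(y), and ⟨a⟩z′ = ⟨b⟩z because a, being fresh for y′, is fresh for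
-- every element of the uniformly supported set h(y′). This yields uniform finite
-- support of [𝔸]h and preservation of composition; identities, J and monotonicity
-- are immediate.

open import Defs
open import Data.Nat using (suc; _≟_)
open import Data.Nat.Properties using (1+n≰n)
open import Data.List using (List; []; _∷_; _++_; map)
open import Data.List.Extrema.Nat using (max; xs≤max)
open import Data.List.Membership.Propositional using (_∈_; _∉_)
open import Data.List.Membership.Propositional.Properties using (∈-++⁺ˡ; ∈-++⁺ʳ; ∈-map⁺; ∈-map⁻)
open import Data.List.Relation.Unary.All as All using ()
open import Data.List.Relation.Unary.Any using (here; there)
open import Data.Product using (∃; ∃-syntax; _×_; _,_; proj₁; proj₂)
open import Data.Empty using (⊥-elim)
open import Function using (_∘_)
open import Relation.Nullary using (yes; no)
open import Relation.Binary using (Setoid)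
open import Relation.Binary.PropositionalEquality using (_≡_; _≢_; refl; sym; trans; cong; subst; module ≡-Reasoning)
import Relation.Binary.Reasoning.Setoid as SetoidReasoning

fresh : List Name → Name
fresh L = suc (max 0 L)

fresh-∉ : ∀ L → fresh L ∉ L
fresh-∉ L m = 1+n≰n (All.lookup (xs≤max 0 L) m)

∉-∷⁻ʰ : ∀ {c a : Name} {L} → c ∉ a ∷ L → c ≢ a
∉-∷⁻ʰ c∉ c≡a = c∉ (here c≡a)

∉-∷⁻ᵗ : ∀ {c a : Name} {L} → c ∉ a ∷ L → c ∉ L
∉-∷⁻ᵗ c∉ c∈ = c∉ (there c∈)

∉-++⁻ˡ : ∀ {c : Name} {L} M → c ∉ L ++ M → c ∉ L
∉-++⁻ˡ M c∉ c∈ = c∉ (∈-++⁺ˡ c∈)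

∉-++⁻ʳ : ∀ {c : Name} L {M} → c ∉ L ++ M → c ∉ M
∉-++⁻ʳ L c∉ c∈ = c∉ (∈-++⁺ʳ L c∈)

swap-left : ∀ a b → swapName a b a ≡ b
swap-left a b with a ≟ a
... | yes _  = refl
... | no a≢a = ⊥-elim (a≢a refl)

swap-right : ∀ a b → swapName a b b ≡ a
swap-right a b with b ≟ a | b ≟ b
... | yes b≡a | _      = b≡a
... | no _    | yes _  = refl
... | no _    | no b≢b = ⊥-elim (b≢b refl)

swap-other : ∀ {a b n} → n ≢ a → n ≢ b → swapName a b n ≡ n
swap-other {a} {b} {n} n≢a n≢b with n ≟ a | n ≟ b
... | yes n≡a | _       = ⊥-elim (n≢a n≡a)
... | no _    | yes n≡b = ⊥-elim (n≢b n≡b)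
... | no _    | no _    = refl

swap-self : ∀ a n → swapName a a n ≡ n
swap-self a n with n ≟ a
... | yes refl = refl
... | no _     = refl

swap-involutive : ∀ a b n → swapName a b (swapName a b n) ≡ n
swap-involutive a b n with n ≟ a | n ≟ b
... | yes refl | _        = swap-right n b
... | no _     | yes refl = swap-left a n
... | no n≢a   | no n≢b   = swap-other n≢a n≢b

sw : Name → Name → Perm
sw a b = (a , b) ∷ []

⟦⟧-++ : ∀ p q n → ⟦ p ++ q ⟧ n ≡ ⟦ p ⟧ (⟦ q ⟧ n)
⟦⟧-++ []            q n = refl
⟦⟧-++ ((a , b) ∷ p) q n = cong (swapName a b) (⟦⟧-++ p q n)

inverse : Perm → Perm
inverse []      = []
inverse (t ∷ p) = inverse p ++ t ∷ []

⟦⟧-inverseˡ : ∀ p n → ⟦ inverse p ⟧ (⟦ p ⟧ n) ≡ n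
⟦⟧-inverseˡ []            n = refl
⟦⟧-inverseˡ ((a , b) ∷ p) n = begin
  ⟦ inverse p ++ sw a b ⟧ (swapName a b (⟦ p ⟧ n))
    ≡⟨ ⟦⟧-++ (inverse p) (sw a b) _ ⟩
  ⟦ inverse p ⟧ (swapName a b (swapName a b (⟦ p ⟧ n)))
    ≡⟨ cong ⟦ inverse p ⟧ (swap-involutive a b _) ⟩
  ⟦ inverse p ⟧ (⟦ p ⟧ n)
    ≡⟨ ⟦⟧-inverseˡ p n ⟩
  n ∎
  where open ≡-Reasoning

⟦⟧-inverseʳ : ∀ p n → ⟦ p ⟧ (⟦ inverse p ⟧ n) ≡ n
⟦⟧-inverseʳ []            n = refl
⟦⟧-inverseʳ ((a , b) ∷ p) n = begin
  swapName a b (⟦ p ⟧ (⟦ inverse p ++ sw a b ⟧ n))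
    ≡⟨ cong (swapName a b ∘ ⟦ p ⟧) (⟦⟧-++ (inverse p) (sw a b) n) ⟩
  swapName a b (⟦ p ⟧ (⟦ inverse p ⟧ (swapName a b n)))
    ≡⟨ cong (swapName a b) (⟦⟧-inverseʳ p _) ⟩
  swapName a b (swapName a b n)
    ≡⟨ swap-involutive a b n ⟩
  n ∎
  where open ≡-Reasoning

⟦⟧-injective : ∀ p {m n} → ⟦ p ⟧ m ≡ ⟦ p ⟧ n → m ≡ n
⟦⟧-injective p {m} {n} eq =
  trans (sym (⟦⟧-inverseˡ p m)) (trans (cong ⟦ inverse p ⟧ eq) (⟦⟧-inverseˡ p n))

⟦⟧-conjugate-swap : ∀ p a b n → swapName (⟦ p ⟧ a) (⟦ p ⟧ b) (⟦ p ⟧ n) ≡ ⟦ p ⟧ (swapName a b n)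
⟦⟧-conjugate-swap p a b n with n ≟ a | n ≟ b
... | yes refl | _        = swap-left (⟦ p ⟧ n) (⟦ p ⟧ b)
... | no _     | yes refl = swap-right (⟦ p ⟧ a) (⟦ p ⟧ n)
... | no n≢a   | no n≢b   = swap-other (n≢a ∘ ⟦⟧-injective p) (n≢b ∘ ⟦⟧-injective p)

∉-map-⟦⟧ : ∀ p {c} {A : List Name} → c ∉ A → ⟦ p ⟧ c ∉ map ⟦ p ⟧ A
∉-map-⟦⟧ p c∉A m with ∈-map⁻ ⟦ p ⟧ m
... | n , n∈A , pc≡pn = c∉A (subst (_∈ _) (sym (⟦⟧-injective p pc≡pn)) n∈A)

module Nominal (X : NomSet) where

  open IsNominal (isNominal X) public

  Elem : Set
  Elem = Carrier (str X)

  infix 4 _≃_ _#_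
  infixr 5 _·_

  _≃_ : Elem → Elem → Set
  _≃_ = _≈_ (str X)

  _·_ : Perm → Elem → Elem
  _·_ = act (str X)

  _#_ : Name → Elem → Set
  _#_ = Fresh (str X)

  setoid : Setoid _ _
  setoid = record { Carrier = Elem ; _≈_ = _≃_ ; isEquivalence = isEquivalence }

  open Setoid setoid public using () renaming (refl to ≃-refl; sym to ≃-sym; trans to ≃-trans)
  module ≃-Reasoning = SetoidReasoning setoid
  open ≃-Reasoning

  act-trivial : ∀ {p} → (∀ n → ⟦ p ⟧ n ≡ n) → ∀ x → p · x ≃ x
  act-trivial {p} fix x = ≃-trans (act-ext p [] fix x) (act-id x)

  act-cancel : ∀ {p q} → (∀ n → ⟦ p ⟧ (⟦ q ⟧ n) ≡ n) → ∀ x → p · q · x ≃ x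
  act-cancel {p} {q} cancel x =
    ≃-trans (≃-sym (act-comp p q x)) (act-trivial (λ n → trans (⟦⟧-++ p q n) (cancel n)) x)

  swap-act-involutive : ∀ a b x → sw a b · sw a b · x ≃ x
  swap-act-involutive a b = act-cancel (swap-involutive a b)

  act-∘-≗ : ∀ {p q p′ q′} → (∀ n → ⟦ p ⟧ (⟦ q ⟧ n) ≡ ⟦ p′ ⟧ (⟦ q′ ⟧ n)) →
            ∀ x → p · q · x ≃ p′ · q′ · x
  act-∘-≗ {p} {q} {p′} {q′} pointwise x = begin
    p · q · x      ≈⟨ act-comp p q x ⟨
    (p ++ q) · x   ≈⟨ act-ext (p ++ q) (p′ ++ q′) pointwise-++ x ⟩
    (p′ ++ q′) · x ≈⟨ act-comp p′ q′ x ⟩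
    p′ · q′ · x    ∎
    where
    pointwise-++ : ∀ n → ⟦ p ++ q ⟧ n ≡ ⟦ p′ ++ q′ ⟧ n
    pointwise-++ n = trans (⟦⟧-++ p q n) (trans (pointwise n) (sym (⟦⟧-++ p′ q′ n)))

  act-conjugate-swap : ∀ p {a c a′ c′} → ⟦ p ⟧ a ≡ a′ → ⟦ p ⟧ c ≡ c′ →
                       ∀ x → sw a′ c′ · p · x ≃ p · sw a c · x
  act-conjugate-swap p {a} {c} refl refl = act-∘-≗ (⟦⟧-conjugate-swap p a c)

  support : Elem → List Name
  support x = proj₁ (finSupp x)

  fresh-outside-support : ∀ {c x} → c ∉ support x → c # x
  fresh-outside-support {x = x} c∉ = support x , proj₂ (finSupp x) , c∉

  supports-≃ : ∀ {A x y} → Supports (str X) A x → x ≃ y → Supports (str X) A y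
  supports-≃ {x = x} {y} sA x≃y p fixA = begin
    p · y ≈⟨ act-cong p y x (≃-sym x≃y) ⟩
    p · x ≈⟨ sA p fixA ⟩
    x     ≈⟨ x≃y ⟩
    y     ∎

  supports-act : ∀ {A x} p → Supports (str X) A x → Supports (str X) (map ⟦ p ⟧ A) (p · x)
  supports-act {A} {x} p sA q fixpA = begin
    q · p · x  ≈⟨ act-∘-≗ (λ n → sym (trans (cong ⟦ p ⟧ (⟦r⟧ n)) (⟦⟧-inverseʳ p _))) x ⟩
    p · r · x  ≈⟨ act-cong p (r · x) x (sA r fixA) ⟩
    p · x      ∎
    where
    r : Perm
    r = inverse p ++ q ++ p
    ⟦r⟧ : ∀ n → ⟦ r ⟧ n ≡ ⟦ inverse p ⟧ (⟦ q ⟧ (⟦ p ⟧ n))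
    ⟦r⟧ n = trans (⟦⟧-++ (inverse p) (q ++ p) n) (cong ⟦ inverse p ⟧ (⟦⟧-++ q p n))
    fixA : ∀ a → a ∈ A → ⟦ r ⟧ a ≡ a
    fixA a a∈A = trans (⟦r⟧ a) (trans (cong ⟦ inverse p ⟧ (fixpA (⟦ p ⟧ a) (∈-map⁺ ⟦ p ⟧ a∈A)))
                                      (⟦⟧-inverseˡ p a))

  fresh-≃ : ∀ {c x y} → c # x → x ≃ y → c # y
  fresh-≃ (A , sA , c∉A) x≃y = A , supports-≃ sA x≃y , c∉A

  fresh-act : ∀ p {c d x} → ⟦ p ⟧ c ≡ d → c # x → d # p · x
  fresh-act p refl (A , sA , c∉A) = map ⟦ p ⟧ A , supports-act p sA , ∉-map-⟦⟧ p c∉A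

  swap-supported-fixes : ∀ {A x c d} → Supports (str X) A x → c ∉ A → d ∉ A → sw c d · x ≃ x
  swap-supported-fixes {A} sA c∉A d∉A = sA (sw _ _) λ n n∈A →
    swap-other (λ n≡c → c∉A (subst (_∈ A) n≡c n∈A)) (λ n≡d → d∉A (subst (_∈ A) n≡d n∈A))

  -- Through a third name e fresh for everything: (c d) = (c e)(e d)(c e).
  swap-fresh-fixes : ∀ {c d x} → c # x → d # x → sw c d · x ≃ x
  swap-fresh-fixes {c} {d} {x} (A , sA , c∉A) (B , sB , d∉B) with c ≟ d
  ... | yes refl = act-trivial (swap-self c) x
  ... | no c≢d   = begin
    sw c d · x             ≈⟨ act-cong (sw c d) x _ (≃-sym (swap-supported-fixes sA c∉A e∉A)) ⟩
    sw c d · sw c e · x    ≈⟨ act-conjugate-swap (sw c e) (swap-right c e) (swap-other (c≢d ∘ sym) d≢e) x ⟩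
    sw c e · sw e d · x    ≈⟨ act-cong (sw c e) _ x (swap-supported-fixes sB e∉B d∉B) ⟩
    sw c e · x             ≈⟨ swap-supported-fixes sA c∉A e∉A ⟩
    x                      ∎
    where
    e : Name
    e = fresh (d ∷ A ++ B)
    e∉ : e ∉ d ∷ A ++ B
    e∉ = fresh-∉ (d ∷ A ++ B)
    d≢e : d ≢ e
    d≢e = ∉-∷⁻ʰ e∉ ∘ sym
    e∉A : e ∉ A
    e∉A = ∉-++⁻ˡ B (∉-∷⁻ᵗ e∉)
    e∉B : e ∉ B
    e∉B = ∉-++⁻ʳ A (∉-∷⁻ᵗ e∉)

  swap-fresh-conjugate : ∀ {a c g x} → a ≢ c → a ≢ g → c # x → g # x →
                         sw a g · x ≃ sw c g · sw a c · x
  swap-fresh-conjugate {a} {c} {g} {x} a≢c a≢g c#x g#x = begin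
    sw a g · x           ≈⟨ act-cong (sw a g) x _ (≃-sym (swap-fresh-fixes c#x g#x)) ⟩
    sw a g · sw c g · x  ≈⟨ act-conjugate-swap (sw c g) (swap-other a≢c a≢g) (swap-left c g) x ⟩
    sw c g · sw a c · x  ∎

module Abstraction (X : NomSet) where

  open Nominal X
  open ≃-Reasoning

  infix 4 _∼_

  _∼_ : Name × Elem → Name × Elem → Set
  _∼_ = _≈_ (Abs X)

  -- Some fresh c witnesses (a , x) ∼ (b , y), hence every fresh g does.
  ∼⇒swap-≃ : ∀ {a b g x y} → (a , x) ∼ (b , y) → g ≢ a → g ≢ b → g # x → g # y →
             sw a g · x ≃ sw b g · y
  ∼⇒swap-≃ {a} {b} {g} {x} {y} (c , c≢a , c≢b , c#x , c#y , eq) g≢a g≢b g#x g#y = begin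
    sw a g · x           ≈⟨ swap-fresh-conjugate (c≢a ∘ sym) (g≢a ∘ sym) c#x g#x ⟩
    sw c g · sw a c · x  ≈⟨ act-cong (sw c g) _ _ eq ⟩
    sw c g · sw b c · y  ≈⟨ swap-fresh-conjugate (c≢b ∘ sym) (g≢b ∘ sym) c#y g#y ⟨
    sw b g · y           ∎

  ∼-cong : ∀ {a b x y} → a ≡ b → x ≃ y → (a , x) ∼ (b , y)
  ∼-cong {a} {x = x} refl x≃y = c , c≢a , c≢a , c#x , fresh-≃ c#x x≃y , act-cong (sw a c) _ _ x≃y
    where
    c : Name
    c = fresh (a ∷ support x)
    c≢a : c ≢ a
    c≢a = ∉-∷⁻ʰ (fresh-∉ (a ∷ support x))
    c#x : c # x
    c#x = fresh-outside-support (∉-∷⁻ᵗ (fresh-∉ (a ∷ support x)))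

  ∼-refl : ∀ {u} → u ∼ u
  ∼-refl = ∼-cong refl ≃-refl

  ∼-sym : ∀ {u v} → u ∼ v → v ∼ u
  ∼-sym (c , c≢a , c≢b , c#x , c#y , eq) = c , c≢b , c≢a , c#y , c#x , ≃-sym eq

  ∼-trans : ∀ {u v w} → u ∼ v → v ∼ w → u ∼ w
  ∼-trans {a , x} {b , y} {d , w} u∼v v∼w =
    g , g≢a , g≢d , g#x , g#w ,
    ≃-trans (∼⇒swap-≃ u∼v g≢a g≢b g#x g#y) (∼⇒swap-≃ v∼w g≢b g≢d g#y g#w)
    where
    L : List Name
    L = support x ++ support y ++ support w
    g : Name
    g = fresh (a ∷ b ∷ d ∷ L)
    g∉ : g ∉ a ∷ b ∷ d ∷ L
    g∉ = fresh-∉ (a ∷ b ∷ d ∷ L)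
    g≢a : g ≢ a
    g≢a = ∉-∷⁻ʰ g∉
    g≢b : g ≢ b
    g≢b = ∉-∷⁻ʰ (∉-∷⁻ᵗ g∉)
    g≢d : g ≢ d
    g≢d = ∉-∷⁻ʰ (∉-∷⁻ᵗ (∉-∷⁻ᵗ g∉))
    g∉L : g ∉ L
    g∉L = ∉-∷⁻ᵗ (∉-∷⁻ᵗ (∉-∷⁻ᵗ g∉))
    g#x : g # x
    g#x = fresh-outside-support (∉-++⁻ˡ _ g∉L)
    g#y : g # y
    g#y = fresh-outside-support (∉-++⁻ˡ _ (∉-++⁻ʳ (support x) g∉L))
    g#w : g # w
    g#w = fresh-outside-support (∉-++⁻ʳ (support y) (∉-++⁻ʳ (support x) g∉L))

  ∼-act : ∀ p {u v} → u ∼ v → act (Abs X) p u ∼ act (Abs X) p v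
  ∼-act p {a , x} {b , y} (c , c≢a , c≢b , c#x , c#y , eq) =
    ⟦ p ⟧ c , c≢a ∘ ⟦⟧-injective p , c≢b ∘ ⟦⟧-injective p ,
    fresh-act p refl c#x , fresh-act p refl c#y , (begin
      sw (⟦ p ⟧ a) (⟦ p ⟧ c) · p · x  ≈⟨ act-conjugate-swap p refl refl x ⟩
      p · sw a c · x                  ≈⟨ act-cong p _ _ eq ⟩
      p · sw b c · y                  ≈⟨ act-conjugate-swap p refl refl y ⟨
      sw (⟦ p ⟧ b) (⟦ p ⟧ c) · p · y  ∎)

  ∼-inverse : ∀ p u → act (Abs X) (inverse p) (act (Abs X) p u) ∼ u
  ∼-inverse p (a , x) = ∼-cong (⟦⟧-inverseˡ p a) (act-cancel (⟦⟧-inverseˡ p) x)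

  ∼-same-name : ∀ {a x y} → (a , x) ∼ (a , y) → x ≃ y
  ∼-same-name {a} {x} {y} (c , _ , _ , _ , _ , eq) = begin
    x                   ≈⟨ swap-act-involutive a c x ⟨
    sw a c · sw a c · x ≈⟨ act-cong (sw a c) _ _ eq ⟩
    sw a c · sw a c · y ≈⟨ swap-act-involutive a c y ⟩
    y                   ∎

  ∼-distinct⇒fresh : ∀ {a b x y} → a ≢ b → (a , x) ∼ (b , y) → a # y
  ∼-distinct⇒fresh {a} {b} {x} {y} a≢b (c , c≢a , _ , c#x , _ , eq) = fresh-≃ a#swapped swapped≃y
    where
    a#swapped : a # sw b c · sw a c · x
    a#swapped = fresh-act (sw b c) (swap-other a≢b (c≢a ∘ sym)) (fresh-act (sw a c) (swap-right a c) c#x)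
    swapped≃y : sw b c · sw a c · x ≃ y
    swapped≃y = begin
      sw b c · sw a c · x  ≈⟨ act-cong (sw b c) _ _ eq ⟩
      sw b c · sw b c · y  ≈⟨ swap-act-involutive b c y ⟩
      y                    ∎

  abs-supports : ∀ {A a x} → Supports (str X) A x → Supports (Abs X) (a ∷ A) (a , x)
  abs-supports sA p fix = ∼-cong (fix _ (here refl)) (sA p (λ n → fix n ∘ there))

  abs-supports-∼ : ∀ {A u v} → Supports (Abs X) A u → u ∼ v → Supports (Abs X) A v
  abs-supports-∼ sA u∼v p fix = ∼-trans (∼-act p (∼-sym u∼v)) (∼-trans (sA p fix) u∼v)

module Morphisms (X Z : NomSet) where

  module NX = Nominal X
  open NX using (_#_; support; fresh-outside-support; swap-supported-fixes)
  open Abstraction X using (_∼_; ∼⇒swap-≃; ∼-same-name; ∼-distinct⇒fresh)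
  module NZ = Nominal Z
  module AZ = Abstraction Z
  open NZ using (_·_; ≃-refl; ≃-sym; ≃-trans; fresh-≃; fresh-act; swap-act-involutive)

  supports-fun : ∀ (f : EqMap X Z) {A x} → Supports (str X) A x → Supports (str Z) A (fun f x)
  supports-fun f {x = x} sA p fixA =
    ≃-trans (≃-sym (EqMap.equivariant f p x)) (fun-cong f _ _ (sA p fixA))

  ∼-fun : ∀ (f : EqMap X Z) {a b x y} → (a , x) ∼ (b , y) → (a , fun f x) AZ.∼ (b , fun f y)
  ∼-fun f {a} {b} {x} {y} (c , c≢a , c≢b , (A , sA , c∉A) , (B , sB , c∉B) , eq) =
    c , c≢a , c≢b , (A , supports-fun f sA , c∉A) , (B , supports-fun f sB , c∉B) ,
    ≃-trans (≃-sym (EqMap.equivariant f (sw a c) x))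
            (≃-trans (fun-cong f _ _ eq) (EqMap.equivariant f (sw b c) y))

  rel-preserves-fresh : ∀ (h : KlHom (str X) (str Z)) {a x z} → a # x → rel h x z → a NZ.# z
  rel-preserves-fresh h {a} {x} {z} (A , sA , a∉A) r =
    fresh-≃ (fresh-act (sw a d) (swap-right a d) d#swapped) (swap-act-involutive a d z)
    where
    Ah : List Name
    Ah = proj₁ (ufs h x)
    d : Name
    d = fresh (a ∷ A ++ Ah)
    d∉ : d ∉ A ++ Ah
    d∉ = ∉-∷⁻ᵗ (fresh-∉ (a ∷ A ++ Ah))
    swapped-output : rel h x (sw a d · z)
    swapped-output = rel-cong h _ _ _ _ (swap-supported-fixes sA a∉A (∉-++⁻ˡ Ah d∉)) ≃-refl
                       (KlHom.equivariant h (sw a d) x z r)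
    d#swapped : d NZ.# sw a d · z
    d#swapped = Ah , proj₂ (ufs h x) _ swapped-output , ∉-++⁻ʳ A d∉

  ∼-transport-distinct : ∀ (h : KlHom (str X) (str Z)) {a b y y′ z} → a ≢ b →
    (a , y) ∼ (b , y′) → rel h y′ z → ∃[ z′ ] rel h y z′ × (a , z′) AZ.∼ (b , z)
  ∼-transport-distinct h {a} {b} {y} {y′} {z} a≢b e r =
    z′ , output , c , c≢a , c≢b , c#z′ , c#z , swap-act-involutive a c _
    where
    Ah : List Name
    Ah = proj₁ (ufs h y′)
    L : List Name
    L = support y ++ support y′ ++ Ah
    c : Name
    c = fresh (a ∷ b ∷ L)
    c∉ : c ∉ a ∷ b ∷ L
    c∉ = fresh-∉ (a ∷ b ∷ L)
    c≢a : c ≢ a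
    c≢a = ∉-∷⁻ʰ c∉
    c≢b : c ≢ b
    c≢b = ∉-∷⁻ʰ (∉-∷⁻ᵗ c∉)
    c∉L : c ∉ L
    c∉L = ∉-∷⁻ᵗ (∉-∷⁻ᵗ c∉)
    c#y : c # y
    c#y = fresh-outside-support (∉-++⁻ˡ _ c∉L)
    c#y′ : c # y′
    c#y′ = fresh-outside-support (∉-++⁻ˡ Ah (∉-++⁻ʳ (support y) c∉L))
    c#z : c NZ.# z
    c#z = Ah , proj₂ (ufs h y′) z r , ∉-++⁻ʳ (support y′) (∉-++⁻ʳ (support y) c∉L)
    z′ : NZ.Elem
    z′ = sw a c · sw b c · z
    a#z : a NZ.# z
    a#z = rel-preserves-fresh h (∼-distinct⇒fresh a≢b e) r
    c#z′ : c NZ.# z′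
    c#z′ = fresh-act (sw a c) (swap-left a c) (fresh-act (sw b c) (swap-other a≢b (c≢a ∘ sym)) a#z)
    swapped-input : rel h (sw a c NX.· y) (sw b c · z)
    swapped-input = rel-cong h _ _ _ _ (NX.≃-sym (∼⇒swap-≃ e c≢a c≢b c#y c#y′)) ≃-refl
                      (KlHom.equivariant h (sw b c) y′ z r)
    output : rel h y z′
    output = rel-cong h _ _ _ _ (NX.swap-act-involutive a c y) ≃-refl
               (KlHom.equivariant h (sw a c) _ _ swapped-input)

  ∼-transport : ∀ (h : KlHom (str X) (str Z)) {a b y y′ z} →
    (a , y) ∼ (b , y′) → rel h y′ z → ∃[ z′ ] rel h y z′ × (a , z′) AZ.∼ (b , z)
  ∼-transport h {a} {b} e r with a ≟ b
  ... | yes refl = _ , rel-cong h _ _ _ _ (NX.≃-sym (∼-same-name e)) ≃-refl r , AZ.∼-refl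
  ... | no a≢b   = ∼-transport-distinct h a≢b e r

module Lifting (X Y : NomSet) where

  open Abstraction X using (_∼_; ∼-sym; ∼-trans; ∼-act; ∼-inverse)
  module AY = Abstraction Y
  open Morphisms X Y using (∼-transport)

  absRel : KlHom (str X) (str Y) → RelK (Abs X) (Abs Y)
  absRel h u v = ∃[ a ] ∃[ x ] ∃[ z ] u ∼ (a , x) × rel h x z × (a , z) AY.∼ v

  absRel-cong : ∀ h u u′ v v′ → u ∼ u′ → v AY.∼ v′ → absRel h u v → absRel h u′ v′
  absRel-cong h _ _ _ _ u∼u′ v∼v′ (a , x , z , u∼ax , r , az∼v) =
    a , x , z , ∼-trans (∼-sym u∼u′) u∼ax , r , AY.∼-trans az∼v v∼v′

  absRel-equivariant : ∀ h p u v → absRel h u v → absRel h (act (Abs X) p u) (act (Abs Y) p v)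
  absRel-equivariant h p _ _ (a , x , z , u∼ax , r , az∼v) =
    ⟦ p ⟧ a , _ , _ , ∼-act p u∼ax , KlHom.equivariant h p x z r , AY.∼-act p az∼v

  absRel-equivariant⁻ : ∀ h p u v → absRel h (act (Abs X) p u) (act (Abs Y) p v) → absRel h u v
  absRel-equivariant⁻ h p u v r =
    absRel-cong h _ u _ v (∼-inverse p u) (AY.∼-inverse p v) (absRel-equivariant h (inverse p) _ _ r)

  absRel-ufs : ∀ h u → ∃ λ (B : List Name) → ∀ v → absRel h u v → Supports (Abs Y) B v
  absRel-ufs h (a , x) = a ∷ proj₁ (ufs h x) , λ v (a′ , x′ , z , ax∼ , r , az∼v) →
    let (z′ , r′ , az′∼az) = ∼-transport h ax∼ r
    in AY.abs-supports-∼ (AY.abs-supports (proj₂ (ufs h x) z′ r′)) (AY.∼-trans az′∼az az∼v)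

  absKl : KlHom (str X) (str Y) → KlHom (Abs X) (Abs Y)
  absKl h = record
    { rel          = absRel h
    ; rel-cong     = absRel-cong h
    ; equivariant  = absRel-equivariant h
    ; equivariant⁻ = absRel-equivariant⁻ h
    ; ufs          = absRel-ufs h
    }

absKl-id : ∀ {X : NomSet} (h : KlHom (str X) (str X)) →
  _≐ʳ_ {str X} {str X} (rel h) (idʳ (str X)) →
  _≐ʳ_ {Abs X} {Abs X} (rel (Lifting.absKl X X h)) (idʳ (Abs X))
absKl-id {X} h (h⊆id , id⊆h) =
  (λ { _ _ (_ , x , z , u∼ax , r , az∼v) → ∼-trans u∼ax (∼-trans (∼-cong refl (h⊆id x z r)) az∼v) }) ,
  (λ { (a , x) _ u∼v → a , x , x , ∼-refl , id⊆h x x (Nominal.≃-refl X) , u∼v })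
  where open Abstraction X

absKl-J : ∀ {X Y : NomSet} (f : EqMap X Y) (h : KlHom (str X) (str Y)) →
  _≐ʳ_ {str X} {str Y} (rel h) (graphʳ {str X} (str Y) (fun f)) →
  _≐ʳ_ {Abs X} {Abs Y} (rel (Lifting.absKl X Y h)) (graphʳ {Abs X} (Abs Y) (Absmap X Y f))
absKl-J {X} {Y} f h (h⊆f , f⊆h) =
  (λ { _ _ (_ , x′ , z , ax∼ , r , az∼v) →
       AY.∼-trans (Morphisms.∼-fun X Y f ax∼) (AY.∼-trans (AY.∼-cong refl (h⊆f x′ z r)) az∼v) }) ,
  (λ { (a , x) _ fu∼v →
       a , x , fun f x , Abstraction.∼-refl X , f⊆h x (fun f x) (Nominal.≃-refl Y) , fu∼v })
  where module AY = Abstraction Y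

absKl-comp : ∀ {X Y Z : NomSet} (f : KlHom (str X) (str Y)) (g : KlHom (str Y) (str Z))
  (h : KlHom (str X) (str Z)) →
  _≐ʳ_ {str X} {str Z} (rel h) (_•ʳ_ {str X} {str Y} {str Z} (rel g) (rel f)) →
  _≐ʳ_ {Abs X} {Abs Z} (rel (Lifting.absKl X Z h))
       (_•ʳ_ {Abs X} {Abs Y} {Abs Z} (rel (Lifting.absKl Y Z g)) (rel (Lifting.absKl X Y f)))
absKl-comp {X} {Y} {Z} f g h (h⊆gf , gf⊆h) =
  (λ { _ _ (a , x , z , u∼ax , r , az∼w) →
       let (y , fy , gz) = h⊆gf x z r
       in (a , y) , (a , x , y , u∼ax , fy , AY.∼-refl) , (a , y , z , AY.∼-refl , gz , az∼w) }) ,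
  (λ { _ _ (_ , (a , x , y , u∼ax , fy , ay∼) , (_ , _ , z , ∼by′ , gz , bz∼w)) →
       let (z′ , gz′ , az′∼bz) = Morphisms.∼-transport Y Z g (AY.∼-trans ay∼ ∼by′) gz
       in a , x , z′ , u∼ax , gf⊆h x z′ (y , fy , gz′) , AZ.∼-trans az′∼bz bz∼w })
  where
  module AY = Abstraction Y
  module AZ = Abstraction Z

absKl-mono : ∀ {X Y : NomSet} (f g : KlHom (str X) (str Y)) →
  _⊆ʳ_ {str X} {str Y} (rel f) (rel g) →
  _⊆ʳ_ {Abs X} {Abs Y} (rel (Lifting.absKl X Y f)) (rel (Lifting.absKl X Y g))
absKl-mono f g f⊆g _ _ (a , x , z , u∼ax , r , az∼v) = a , x , z , u∼ax , f⊆g x z r , az∼v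

mainTheorem6 : LocallyMonotoneExtension
mainTheorem6 = record
  { ext      = Lifting.absKl
  ; ext-id   = λ {X} → absKl-id {X}
  ; ext-comp = λ {X} {Y} {Z} → absKl-comp {X} {Y} {Z}
  ; ext-J    = λ {X} {Y} → absKl-J {X} {Y}
  ; mono     = λ {X} {Y} → absKl-mono {X} {Y}
  }
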